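{- In the theory TRC the following hold: (a) $\mathrm{Abst}\,\mathrm{Abst}\,\mathrm{Abst}\,\mathrm{Abst}\,\mathrm{Abst}\,\mathrm{Abst} = \mathrm{Id}$; (b) $\mathrm{Abst}\,\mathrm{Abst}\,\mathrm{Abst}\,\mathrm{Abst} = K(K(\mathrm{Id}))$; (c) for all $x,y$: $\mathrm{Abst}\,\mathrm{Abst}\,\mathrm{Abst}\,\mathrm{Abst}\,x\,y = \mathrm{Id}$.
   Context: TRC is the following first-order theory (a system of illative combinatory logic). Its objects are "combinators". The language has a binary operation of application, written by juxtaposition $xy$ (meaning $x$ applied to $y$), with the convention that application associates to the left, i.e. $xyz=(xy)z$; constants $\mathrm{Abst}$, $\mathrm{Eq}$, $p_1$, $p_2$; a binary function symbol $\mathrm{pair}(x,y)$, written $\langle x,y\rangle$; and a unary function symbol $K$ (so $K(x)$ is a term for each term $x$; $K$ is not itself a combinator). The axioms are: I. $K(x)\,y = x$; II. $p_1\langle x_1,x_2\rangle = x_1$ and $p_2\langle x_1,x_2\rangle = x_2$; III. $\langle p_1 x, p_2 x\rangle = x$; IV. $\langle f,g\rangle x = \langle fx, gx\rangle$; V. $\mathrm{Abst}\,x\,y\,z = x\,K(z)\,(y\,z)$; VI. $\mathrm{Eq}\langle x,y\rangle = p_1$ if $x=y$, and $\mathrm{Eq}\langle x,y\rangle = p_2$ if $x\neq y$; VII. (extensionality) if $fx=gx$ for all $x$, then $f=g$; VIII. $p_1\neq p_2$. $\mathrm{Id}$ denotes the identity combinator, i.e. the combinator with $\mathrm{Id}\,x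 = x$ for all $x$ (in TRC one may take $\mathrm{Id}=\langle p_1,p_2\rangle$). The claim asserts that the stated equations are theorems of TRC (hold in every model of TRC). -}

module Defs where

open import Level using (Level; suc)
open import Relation.Binary.PropositionalEquality using (_≡_)
open import Relation.Nullary using (¬_)

-- A model of the first-order theory TRC.  Equality of the theory is
-- interpreted as propositional equality on the carrier.
record TRC (ℓ : Level) : Set (suc ℓ) where
  infixl 9 _·_
  field
    C     : Set ℓ
    _·_   : C → C → C
    Abst  : C
    Eq    : C
    p₁    : C
    p₂    : C
    pair  : C → C → C
    K     : C → C
    ax-K    : ∀ x y → K x · y ≡ x
    ax-p₁   : ∀ x₁ x₂ → p₁ · pair x₁ x₂ ≡ x₁
    ax-p₂   : ∀ x₁ x₂ → p₂ · pair x₁ x₂ ≡ x₂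
    ax-surj : ∀ x → pair (p₁ · x) (p₂ · x) ≡ x
    ax-pairApp : ∀ f g x → pair f g · x ≡ pair (f · x) (g · x)
    ax-Abst : ∀ x y z → Abst · x · y · z ≡ x · K z · (y · z)
    ax-Eq₁  : ∀ x y → x ≡ y → Eq · pair x y ≡ p₁
    ax-Eq₂  : ∀ x y → ¬ (x ≡ y) → Eq · pair x y ≡ p₂
    ax-ext  : ∀ f g → (∀ x → f · x ≡ g · x) → f ≡ g
    ax-p₁≢p₂ : ¬ (p₁ ≡ p₂)

  Id : C
  Id = pair p₁ p₂

-- Two uses of axiom V give  Abst Abst u v w = v (u v w).  With v = K z the
-- right-hand side collapses to z, and Abst⁴ x y z = Abst (Abst Abst x) y z
-- reduces to exactly Abst Abst x (K z) (y z); so Abst⁴ x y behaves as Id, and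
-- extensionality turns these pointwise equations into (a)–(c).
module Submission where

open import Defs
open import Level using (Level)
open import Data.Product using (_×_; _,_)
open import Relation.Binary.PropositionalEquality using (_≡_; sym; trans; cong)
open Relation.Binary.PropositionalEquality.≡-Reasoning

module TRC-Properties {ℓ : Level} (M : TRC ℓ) where
  open TRC M

  Id-identity : ∀ x → Id · x ≡ x
  Id-identity x = trans (ax-pairApp p₁ p₂ x) (ax-surj x)

  ext-Id : ∀ f → (∀ x → f · x ≡ x) → f ≡ Id
  ext-Id f fx≡x = ax-ext f Id (λ x → trans (fx≡x x) (sym (Id-identity x)))

  ext-K : ∀ f c → (∀ x → f · x ≡ c) → f ≡ K c
  ext-K f c fx≡c = ax-ext f (K c) (λ x → trans (fx≡c x) (sym (ax-K c x)))

  AbstAbst-β : ∀ u v w → Abst · Abst · u · v · w ≡ v · (u · v · w)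
  AbstAbst-β u v w = begin
    Abst · Abst · u · v · w         ≡⟨ cong (_· w) (ax-Abst Abst u v) ⟩
    Abst · K v · (u · v) · w        ≡⟨ ax-Abst (K v) (u · v) w ⟩
    K v · K w · (u · v · w)         ≡⟨ cong (_· (u · v · w)) (ax-K v (K w)) ⟩
    v · (u · v · w)                 ∎

  AbstAbst-K : ∀ u z w → Abst · Abst · u · K z · w ≡ z
  AbstAbst-K u z w = trans (AbstAbst-β u (K z) w) (ax-K z _)

  Abst⁴-β : ∀ x y z → Abst · Abst · Abst · Abst · x · y · z ≡ z
  Abst⁴-β x y z = begin
    Abst · Abst · Abst · Abst · x · y · z    ≡⟨ cong (λ f → f · y · z) (AbstAbst-β Abst Abst x) ⟩
    Abst · (Abst · Abst · x) · y · z         ≡⟨ ax-Abst (Abst · Abst · x) y z ⟩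
    Abst · Abst · x · K z · (y · z)          ≡⟨ AbstAbst-K x z (y · z) ⟩
    z                                        ∎

  Abst⁴·x·y≡Id : ∀ x y → Abst · Abst · Abst · Abst · x · y ≡ Id
  Abst⁴·x·y≡Id x y = ext-Id _ (Abst⁴-β x y)

  Abst⁴≡K[K[Id]] : Abst · Abst · Abst · Abst ≡ K (K Id)
  Abst⁴≡K[K[Id]] = ext-K _ (K Id) (λ x → ext-K _ Id (Abst⁴·x·y≡Id x))

proposition1 : ∀ {ℓ : Level} (M : TRC ℓ) → let open TRC M in
    (Abst · Abst · Abst · Abst · Abst · Abst ≡ Id)
    × (Abst · Abst · Abst · Abst ≡ K (K Id))
    × (∀ x y → Abst · Abst · Abst · Abst · x · y ≡ Id)
proposition1 M = Abst⁴·x·y≡Id Abst Abst , Abst⁴≡K[K[Id]] , Abst⁴·x·y≡Id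
  where open TRC M
        open TRC-Properties M
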